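{- For every integer $k\geq 2$ and every integer $n\geq 2$, $\partial\mathcal{F}_n(\mathbf{t}^{(k)})=\Sigma_k^2$, i.e., for every pair of letters $a,b\in\Sigma_k$ there is a factor of $\mathbf{t}^{(k)}$ of length $n$ beginning with $a$ and ending with $b$.
   Context: Let $\Sigma_k=\{0,\dots,k-1\}$, let $\sigma_k$ be the morphism $\sigma_k(i)=i(i+1)\cdots(i+k-1)$ (letters mod $k$), and $\mathbf{t}^{(k)}=\sigma_k^\infty(0)$ its fixed point starting with $0$. $\mathcal{F}_n(\mathbf{w})$ is the set of factors of length $n$ of $\mathbf{w}$; for $u=u_0\cdots u_{n-1}$, $\partial u=u_0u_{n-1}$, and $\partial\mathcal{F}_n(\mathbf{w})=\{\partial u:u\in\mathcal{F}_n(\mathbf{w})\}$. -}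

module Defs where

open import Data.Nat using (ℕ; zero; suc; _+_; _∸_; _<_; _≤_)
open import Data.Nat.Properties using (≤-refl)
open import Data.Fin using (Fin; fromℕ<; toℕ) renaming (zero to fzero)
open import Data.Fin.Properties using ()
open import Data.List using (List; []; _∷_; concatMap; upTo; map; length; lookup)
open import Data.Product using (Σ; _×_; _,_; ∃)
open import Data.Maybe using (Maybe; just; nothing)
open import Relation.Binary.PropositionalEquality using (_≡_)
open import Data.Nat.DivMod using (_%_)

_⊕_ : {k : ℕ} → Fin (suc k) → ℕ → Fin (suc k)
_⊕_ {k} i r = fromℕ< (Data.Nat.DivMod.m%n<n (toℕ i + r) (suc k))
  where import Data.Nat.DivMod

-- σ_k(i) = i (i+1) ... (i+k-1)   (we write k = suc k' so that Σ_k is nonempty)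
σ : (k' : ℕ) → Fin (suc k') → List (Fin (suc k'))
σ k' i = map (i ⊕_) (upTo (suc k'))

σ* : (k' : ℕ) → List (Fin (suc k')) → List (Fin (suc k'))
σ* k' = concatMap (σ k')

iter : (k' : ℕ) → ℕ → List (Fin (suc k'))
iter k' zero = fzero ∷ []
iter k' (suc j) = σ* k' (iter k' j)

_!!_ : {A : Set} → List A → ℕ → Maybe A
[] !! _ = nothing
(x ∷ xs) !! zero = just x
(x ∷ xs) !! suc m = xs !! m

-- The fixed point t^(k) = σ_k^∞(0), as an infinite word ℕ → Σ_k:
-- its m-th letter is the m-th letter of σ_k^{m+1}(0) (a prefix of t^(k) of length k^{m+1} > m
-- when k ≥ 2; the default value is never used for k ≥ 2).
t : (k' : ℕ) → ℕ → Fin (suc k')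
t k' m with iter k' (suc m) !! m
... | just a = a
... | nothing = fzero

factorAt : {A : Set} → (ℕ → A) → ℕ → ℕ → List A
factorAt w i zero = []
factorAt w i (suc n) = w i ∷ factorAt w (suc i) n

IsFactor : {A : Set} → (ℕ → A) → ℕ → List A → Set
IsFactor w n u = ∃ λ i → factorAt w i n ≡ u

first : {A : Set} → List A → Maybe A
first [] = nothing
first (x ∷ _) = just x

lastL : {A : Set} → List A → Maybe A
lastL [] = nothing
lastL (x ∷ []) = just x
lastL (x ∷ y ∷ ys) = lastL (y ∷ ys)

InBoundary : {A : Set} → (ℕ → A) → ℕ → A → A → Set
InBoundary w n a b = ∃ λ u → IsFactor w n u × first u ≡ just a × lastL u ≡ just b

-- Write K = k' + 1. Since σ_K(i) = i(i+1)⋯(i+K-1), the fixed point satisfies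
-- t(Kq + r) = t(q) + r (mod K), so t(m) is the base-K digit sum of m modulo K, and
-- t(K^d z + x) = t(z) + t(x) whenever x < K^d.  For a factor of length d + 1 start at
-- i = K^d z + (K^d - d); it ends at i + d = K^d (z + 1), so its boundary letters are
-- t(z) + t(K^d - d) and t(z + 1).  Finally t(z) and t(z + 1) can be prescribed
-- independently: appending a digit K-1 to z lowers t(z) by one and leaves t(z + 1) unchanged.
module Submission where

open import Defs
open import Data.Nat using (ℕ; zero; suc; _+_; _*_; _∸_; _^_; _≤_; _<_; z≤n; s≤s; s≤s⁻¹; NonZero)
open import Data.Nat.Properties
open import Data.Nat.DivMod
open import Data.Nat.Tactic.RingSolver using (solve-∀)
open import Data.Fin using (Fin; toℕ) renaming (zero to fzero)
open import Data.Fin.Properties using (toℕ-fromℕ<; toℕ<n; toℕ-injective)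
open import Data.List using (List; []; _∷_; _++_; length; map; concatMap; upTo; applyUpTo)
open import Data.List.Properties using (length-map; length-applyUpTo)
open import Data.Maybe using (Maybe; just) renaming (map to mapMaybe)
open import Data.Maybe.Properties using (just-injective)
open import Data.Product using (∃; _×_; _,_)
open import Relation.Binary.PropositionalEquality

!!-map : ∀ {A B : Set} (f : A → B) xs m → map f xs !! m ≡ mapMaybe f (xs !! m)
!!-map f []       m       = refl
!!-map f (x ∷ xs) zero    = refl
!!-map f (x ∷ xs) (suc m) = !!-map f xs m

!!-applyUpTo : ∀ {A : Set} (f : ℕ → A) {n r} → r < n → applyUpTo f n !! r ≡ just (f r)
!!-applyUpTo f {suc n} {zero}  _         = refl
!!-applyUpTo f {suc n} {suc r} (s≤s r<n) = !!-applyUpTo (λ x → f (suc x)) r<n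

!!-++ˡ : ∀ {A : Set} (xs ys : List A) {m} → m < length xs → (xs ++ ys) !! m ≡ xs !! m
!!-++ˡ (x ∷ xs) ys {zero}  _         = refl
!!-++ˡ (x ∷ xs) ys {suc m} (s≤s m<n) = !!-++ˡ xs ys m<n

!!-++ʳ : ∀ {A : Set} (xs ys : List A) m → (xs ++ ys) !! (length xs + m) ≡ ys !! m
!!-++ʳ []       ys m = refl
!!-++ʳ (x ∷ xs) ys m = !!-++ʳ xs ys m

!!-concatMap : ∀ {A B : Set} {K r} (f : A → List B) (g : A → B) →
               (∀ x → length (f x) ≡ K) → r < K → (∀ x → f x !! r ≡ just (g x)) →
               ∀ xs q → concatMap f xs !! (K * q + r) ≡ mapMaybe g (xs !! q)
!!-concatMap f g len r<K fx!!r []       q = refl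
!!-concatMap {K = K} {r} f g len r<K fx!!r (x ∷ xs) zero = begin
  (f x ++ concatMap f xs) !! (K * 0 + r) ≡⟨ cong (λ m → (f x ++ concatMap f xs) !! (m + r)) (*-zeroʳ K) ⟩
  (f x ++ concatMap f xs) !! r           ≡⟨ !!-++ˡ (f x) (concatMap f xs) (subst (r <_) (sym (len x)) r<K) ⟩
  f x !! r                               ≡⟨ fx!!r x ⟩
  just (g x)                             ∎
  where open ≡-Reasoning
!!-concatMap {K = K} {r} f g len r<K fx!!r (x ∷ xs) (suc q) = begin
  (f x ++ concatMap f xs) !! (K * suc q + r)        ≡⟨ cong ((f x ++ concatMap f xs) !!_) split ⟩
  (f x ++ concatMap f xs) !! (length (f x) + (K * q + r)) ≡⟨ !!-++ʳ (f x) (concatMap f xs) (K * q + r) ⟩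
  concatMap f xs !! (K * q + r)                     ≡⟨ !!-concatMap f g len r<K fx!!r xs q ⟩
  mapMaybe g (xs !! q)                              ∎
  where
  open ≡-Reasoning
  split : K * suc q + r ≡ length (f x) + (K * q + r)
  split = begin
    K * suc q + r     ≡⟨ cong (_+ r) (*-suc K q) ⟩
    K + K * q + r     ≡⟨ +-assoc K (K * q) r ⟩
    K + (K * q + r)   ≡⟨ cong (_+ (K * q + r)) (sym (len x)) ⟩
    length (f x) + (K * q + r) ∎

lastL-factorAt : ∀ {A : Set} (w : ℕ → A) i m → lastL (factorAt w i (suc m)) ≡ just (w (i + m))
lastL-factorAt w i zero    = cong (λ j → just (w j)) (sym (+-identityʳ i))
lastL-factorAt w i (suc m) = trans (lastL-factorAt w (suc i) m) (cong (λ j → just (w j)) (sym (+-suc i m)))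

factorAt-boundary : ∀ {A : Set} (w : ℕ → A) i m → InBoundary w (suc m) (w i) (w (i + m))
factorAt-boundary w i m = factorAt w i (suc m) , (i , refl) , refl , lastL-factorAt w i m

n<m^n : ∀ {m} → 1 < m → ∀ n → n < m ^ n
n<m^n         1<m zero    = s≤s z≤n
n<m^n {suc m} 1<m (suc n) = begin-strict
  suc n              ≤⟨ n<m^n 1<m n ⟩
  (suc m) ^ n        <⟨ m<m+n _ (≤-trans (s≤s⁻¹ 1<m) (m≤m*n m _)) ⟩
  (suc m) ^ n + m * (suc m) ^ n ∎
  where
  open ≤-Reasoning
  instance _ = m^n≢0 (suc m) n

mapMaybe-extend : ∀ {A B : Set} {f : A → B} {x y : Maybe A} {b} →
                  (∀ {a} → x ≡ just a → y ≡ just a) → mapMaybe f x ≡ just b → mapMaybe f y ≡ just b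
mapMaybe-extend {x = just a} x⊑y eq rewrite x⊑y refl = eq

[m%n+o]%n≡[m+o]%n : ∀ m o n .{{_ : NonZero n}} → (m % n + o) % n ≡ (m + o) % n
[m%n+o]%n≡[m+o]%n m o n = begin
  (m % n + o) % n           ≡⟨ %-distribˡ-+ (m % n) o n ⟩
  (m % n % n + o % n) % n   ≡⟨ cong (λ x → (x + o % n) % n) (m%n%n≡m%n m n) ⟩
  (m % n + o % n) % n       ≡⟨ %-distribˡ-+ m o n ⟨
  (m + o) % n               ∎
  where open ≡-Reasoning

[m+o%n]%n≡[m+o]%n : ∀ m o n .{{_ : NonZero n}} → (m + o % n) % n ≡ (m + o) % n
[m+o%n]%n≡[m+o]%n m o n = begin
  (m + o % n) % n  ≡⟨ cong (_% n) (+-comm m (o % n)) ⟩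
  (o % n + m) % n  ≡⟨ [m%n+o]%n≡[m+o]%n o m n ⟩
  (o + m) % n      ≡⟨ cong (_% n) (+-comm o m) ⟩
  (m + o) % n      ∎
  where open ≡-Reasoning

module _ (k' : ℕ) (1≤k' : 1 ≤ k') where

  private
    K : ℕ
    K = suc k'

  m≡K*[m/K]+m%K : ∀ m → m ≡ K * (m / K) + m % K
  m≡K*[m/K]+m%K m = trans (m≡m%n+[m/n]*n m K) (trans (+-comm (m % K) _) (cong (_+ m % K) (*-comm (m / K) K)))

  length-σ : ∀ x → length (σ k' x) ≡ K
  length-σ x = trans (length-map (x ⊕_) (upTo K)) (length-applyUpTo (λ y → y) K)

  σ-!! : ∀ {r} → r < K → ∀ x → σ k' x !! r ≡ just (x ⊕ r)
  σ-!! {r} r<K x = trans (!!-map (x ⊕_) (upTo K) r) (cong (mapMaybe (x ⊕_)) (!!-applyUpTo (λ y → y) r<K))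

  iter-suc-!! : ∀ j m → iter k' (suc j) !! m ≡ mapMaybe (_⊕ (m % K)) (iter k' j !! (m / K))
  iter-suc-!! j m = begin
    iter k' (suc j) !! m                    ≡⟨ cong (iter k' (suc j) !!_) (m≡K*[m/K]+m%K m) ⟩
    iter k' (suc j) !! (K * (m / K) + m % K) ≡⟨ !!-concatMap (σ k') (_⊕ (m % K)) length-σ r<K (σ-!! r<K) (iter k' j) (m / K) ⟩
    mapMaybe (_⊕ (m % K)) (iter k' j !! (m / K)) ∎
    where
    open ≡-Reasoning
    r<K = m%n<n m K

  iter-!!-suc : ∀ j {m a} → iter k' j !! m ≡ just a → iter k' (suc j) !! m ≡ just a
  iter-!!-suc zero    {zero} refl = refl
  iter-!!-suc (suc j) {m}    eq   = trans (iter-suc-!! (suc j) m)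
    (mapMaybe-extend (iter-!!-suc j) (trans (sym (iter-suc-!! j m)) eq))

  iter-!!-+ : ∀ l j {m a} → iter k' j !! m ≡ just a → iter k' (l + j) !! m ≡ just a
  iter-!!-+ zero    j eq = eq
  iter-!!-+ (suc l) j eq = iter-!!-suc (l + j) (iter-!!-+ l j eq)

  iter-!!-defined : ∀ j {m} → m < K ^ j → ∃ λ a → iter k' j !! m ≡ just a
  iter-!!-defined zero    {zero}  _ = fzero , refl
  iter-!!-defined zero    {suc m} (s≤s ())
  iter-!!-defined (suc j) {m}    m<K^[1+j]
    with iter-!!-defined j (m<n*o⇒m/o<n (subst (m <_) (*-comm K (K ^ j)) m<K^[1+j]))
  ... | b , eq = b ⊕ (m % K) , trans (iter-suc-!! j m) (cong (mapMaybe (_⊕ (m % K))) eq)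

  iter-!!-t : ∀ m → iter k' (suc m) !! m ≡ just (t k' m)
  iter-!!-t m with iter-!!-defined (suc m) (<-trans (n<1+n m) (n<m^n (s≤s 1≤k') (suc m)))
  ... | a , eq rewrite eq = refl

  t-from-iter : ∀ j {m a} → iter k' j !! m ≡ just a → t k' m ≡ a
  t-from-iter j {m} {a} eq = just-injective (trans (sym t-in-long) a-in-long)
    where
    a-in-long : iter k' (suc m + j) !! m ≡ just a
    a-in-long = iter-!!-+ (suc m) j eq
    t-in-long : iter k' (suc m + j) !! m ≡ just (t k' m)
    t-in-long = subst (λ l → iter k' l !! m ≡ just (t k' m)) (+-comm j (suc m)) (iter-!!-+ j (suc m) (iter-!!-t m))

  t-zero : t k' 0 ≡ fzero
  t-zero = t-from-iter 0 {0} refl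

  t-digit : ∀ q {r} → r < K → t k' (K * q + r) ≡ t k' q ⊕ r
  t-digit q {r} r<K = t-from-iter (suc (suc q)) (begin
    iter k' (suc (suc q)) !! (K * q + r)    ≡⟨ !!-concatMap (σ k') (_⊕ r) length-σ r<K (σ-!! r<K) (iter k' (suc q)) q ⟩
    mapMaybe (_⊕ r) (iter k' (suc q) !! q)  ≡⟨ cong (mapMaybe (_⊕ r)) (iter-!!-t q) ⟩
    just (t k' q ⊕ r)                       ∎)
    where open ≡-Reasoning

  tℕ : ℕ → ℕ
  tℕ m = toℕ (t k' m)

  tℕ%K : ∀ m → tℕ m % K ≡ tℕ m
  tℕ%K m = m<n⇒m%n≡m (toℕ<n (t k' m))

  tℕ-digit : ∀ q {r} → r < K → tℕ (K * q + r) ≡ (tℕ q + r) % K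
  tℕ-digit q r<K = trans (cong toℕ (t-digit q r<K)) (toℕ-fromℕ< _)

  tℕ-K* : ∀ q → tℕ (K * q) ≡ tℕ q
  tℕ-K* q = begin
    tℕ (K * q)        ≡⟨ cong tℕ (+-identityʳ (K * q)) ⟨
    tℕ (K * q + 0)    ≡⟨ tℕ-digit q (s≤s z≤n) ⟩
    (tℕ q + 0) % K    ≡⟨ cong (_% K) (+-identityʳ (tℕ q)) ⟩
    tℕ q % K          ≡⟨ tℕ%K q ⟩
    tℕ q              ∎
    where open ≡-Reasoning

  tℕ-K^* : ∀ L z → tℕ (K ^ L * z) ≡ tℕ z
  tℕ-K^* zero    z = cong tℕ (*-identityˡ z)
  tℕ-K^* (suc L) z = trans (cong tℕ (*-assoc K (K ^ L) z)) (trans (tℕ-K* (K ^ L * z)) (tℕ-K^* L z))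

  tℕ-<K : ∀ {r} → r < K → tℕ r ≡ r
  tℕ-<K {r} r<K = begin
    tℕ r              ≡⟨ cong (λ m → tℕ (m + r)) (*-zeroʳ K) ⟨
    tℕ (K * 0 + r)    ≡⟨ tℕ-digit 0 r<K ⟩
    (tℕ 0 + r) % K    ≡⟨ cong (λ x → (toℕ x + r) % K) t-zero ⟩
    r % K             ≡⟨ m<n⇒m%n≡m r<K ⟩
    r                 ∎
    where open ≡-Reasoning

  tℕ-block : ∀ L z {x} → x < K ^ L → tℕ (K ^ L * z + x) ≡ (tℕ z + tℕ x) % K
  tℕ-block zero    z {zero} _ = begin
    tℕ (1 * z + 0)    ≡⟨ cong tℕ (trans (+-identityʳ (1 * z)) (*-identityˡ z)) ⟩
    tℕ z              ≡⟨ tℕ%K z ⟨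
    tℕ z % K          ≡⟨ cong (_% K) (+-identityʳ (tℕ z)) ⟨
    (tℕ z + 0) % K    ≡⟨ cong (λ y → (tℕ z + toℕ y) % K) t-zero ⟨
    (tℕ z + tℕ 0) % K ∎
    where open ≡-Reasoning
  tℕ-block zero    z {suc x} (s≤s ())
  tℕ-block (suc L) z {x} x<K^[1+L] = begin
    tℕ (K ^ suc L * z + x)          ≡⟨ cong tℕ regroup ⟩
    tℕ (K * (K ^ L * z + q) + r)    ≡⟨ tℕ-digit (K ^ L * z + q) r<K ⟩
    (tℕ (K ^ L * z + q) + r) % K    ≡⟨ cong (λ y → (y + r) % K) (tℕ-block L z q<K^L) ⟩
    ((tℕ z + tℕ q) % K + r) % K     ≡⟨ [m%n+o]%n≡[m+o]%n (tℕ z + tℕ q) r K ⟩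
    (tℕ z + tℕ q + r) % K           ≡⟨ cong (_% K) (+-assoc (tℕ z) (tℕ q) r) ⟩
    (tℕ z + (tℕ q + r)) % K         ≡⟨ [m+o%n]%n≡[m+o]%n (tℕ z) (tℕ q + r) K ⟨
    (tℕ z + (tℕ q + r) % K) % K     ≡⟨ cong (λ y → (tℕ z + y) % K) (tℕ-digit q r<K) ⟨
    (tℕ z + tℕ (K * q + r)) % K     ≡⟨ cong (λ y → (tℕ z + tℕ y) % K) (m≡K*[m/K]+m%K x) ⟨
    (tℕ z + tℕ x) % K               ∎
    where
    open ≡-Reasoning
    q = x / K
    r = x % K
    r<K : r < K
    r<K = m%n<n x K
    q<K^L : q < K ^ L
    q<K^L = m<n*o⇒m/o<n (subst (x <_) (*-comm K (K ^ L)) x<K^[1+L])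
    regroup : K ^ suc L * z + x ≡ K * (K ^ L * z + q) + r
    regroup = trans (cong (K ^ suc L * z +_) (m≡K*[m/K]+m%K x)) (lemma K (K ^ L) z q r)
      where
      lemma : ∀ K P z q r → K * P * z + (K * q + r) ≡ K * (P * z + q) + r
      lemma = solve-∀

  tℕ-jump : ∀ c {a} → a < K → ∃ λ z → tℕ z ≡ a × tℕ (suc z) ≡ (a + suc c) % K
  tℕ-jump zero {a} a<K = K * a , tℕ-z , tℕ-1+z
    where
    tℕ-z : tℕ (K * a) ≡ a
    tℕ-z = trans (tℕ-K* a) (tℕ-<K a<K)
    tℕ-1+z : tℕ (suc (K * a)) ≡ (a + 1) % K
    tℕ-1+z = trans (cong tℕ (+-comm 1 (K * a))) (trans (tℕ-digit a (s≤s 1≤k'))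
               (cong (λ y → (y + 1) % K) (tℕ-<K a<K)))
  tℕ-jump (suc c) {a} a<K with tℕ-jump c (m%n<n (a + 1) K)
  ... | m , tℕ-m , tℕ-1+m = K * m + k' , tℕ-z , tℕ-1+z
    where
    open ≡-Reasoning
    tℕ-z : tℕ (K * m + k') ≡ a
    tℕ-z = begin
      tℕ (K * m + k')           ≡⟨ tℕ-digit m ≤-refl ⟩
      (tℕ m + k') % K           ≡⟨ cong (λ y → (y + k') % K) tℕ-m ⟩
      ((a + 1) % K + k') % K    ≡⟨ [m%n+o]%n≡[m+o]%n (a + 1) k' K ⟩
      (a + 1 + k') % K          ≡⟨ cong (_% K) (+-assoc a 1 k') ⟩
      (a + K) % K               ≡⟨ [m+n]%n≡m%n a K ⟩
      a % K                     ≡⟨ m<n⇒m%n≡m a<K ⟩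
      a                         ∎
    tℕ-1+z : tℕ (suc (K * m + k')) ≡ (a + suc (suc c)) % K
    tℕ-1+z = begin
      tℕ (suc (K * m + k'))     ≡⟨ cong tℕ (+-suc (K * m) k') ⟨
      tℕ (K * m + K)            ≡⟨ cong tℕ (trans (*-suc K m) (+-comm K (K * m))) ⟨
      tℕ (K * suc m)            ≡⟨ tℕ-K* (suc m) ⟩
      tℕ (suc m)                ≡⟨ tℕ-1+m ⟩
      ((a + 1) % K + suc c) % K ≡⟨ [m%n+o]%n≡[m+o]%n (a + 1) (suc c) K ⟩
      (a + 1 + suc c) % K       ≡⟨ cong (_% K) (+-assoc a 1 (suc c)) ⟩
      (a + suc (suc c)) % K     ∎

  tℕ-consecutive : ∀ {a b} → a < K → b < K → ∃ λ z → tℕ z ≡ a × tℕ (suc z) ≡ b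
  tℕ-consecutive {a} {b} a<K b<K with tℕ-jump (k' * suc a + b) a<K
  ... | z , tℕ-z , tℕ-1+z = z , tℕ-z , trans tℕ-1+z (trans (cong (_% K) (wrap k' a b))
                                (trans ([m+kn]%n≡m%n b (suc a) K) (m<n⇒m%n≡m b<K)))
    where
    wrap : ∀ k a b → a + suc (k * suc a + b) ≡ b + suc a * suc k
    wrap = solve-∀

  tℕ-endpoints : ∀ d → 1 ≤ d → ∀ {a b} → a < K → b < K → ∃ λ i → tℕ i ≡ a × tℕ (i + d) ≡ b
  -- Since k' ≡ -1 (mod K), the value a + k' * t(x) is a - t(x) mod K.
  tℕ-endpoints d 1≤d {a} {b} a<K b<K with tℕ-consecutive (m%n<n (a + k' * tℕ (K ^ d ∸ d)) K) b<K
  ... | z , tℕ-z , tℕ-1+z = K ^ d * z + x , tℕ-start , tℕ-end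
    where
    open ≡-Reasoning
    P = K ^ d
    x = P ∸ d
    x+d≡P : x + d ≡ P
    x+d≡P = m∸n+n≡m (<⇒≤ (n<m^n (s≤s 1≤k') d))
    x<P : x < P
    x<P = subst (x <_) x+d≡P (m<m+n x 1≤d)
    tℕ-start : tℕ (P * z + x) ≡ a
    tℕ-start = begin
      tℕ (P * z + x)                        ≡⟨ tℕ-block d z x<P ⟩
      (tℕ z + tℕ x) % K                     ≡⟨ cong (λ y → (y + tℕ x) % K) tℕ-z ⟩
      ((a + k' * tℕ x) % K + tℕ x) % K      ≡⟨ [m%n+o]%n≡[m+o]%n (a + k' * tℕ x) (tℕ x) K ⟩
      (a + k' * tℕ x + tℕ x) % K            ≡⟨ cong (_% K) (cancel k' a (tℕ x)) ⟩
      (a + tℕ x * K) % K                    ≡⟨ [m+kn]%n≡m%n a (tℕ x) K ⟩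
      a % K                                 ≡⟨ m<n⇒m%n≡m a<K ⟩
      a                                     ∎
      where
      cancel : ∀ k a y → a + k * y + y ≡ a + y * suc k
      cancel = solve-∀
    tℕ-end : tℕ (P * z + x + d) ≡ b
    tℕ-end = begin
      tℕ (P * z + x + d)    ≡⟨ cong tℕ (+-assoc (P * z) x d) ⟩
      tℕ (P * z + (x + d))  ≡⟨ cong (λ y → tℕ (P * z + y)) x+d≡P ⟩
      tℕ (P * z + P)        ≡⟨ cong tℕ (trans (+-comm (P * z) P) (sym (*-suc P z))) ⟩
      tℕ (P * suc z)        ≡⟨ tℕ-K^* d (suc z) ⟩
      tℕ (suc z)            ≡⟨ tℕ-1+z ⟩
      b                     ∎

lemma2 : (k' n : ℕ) → 1 ≤ k' → 2 ≤ n →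
    (a b : Fin (suc k')) → InBoundary (t k') n a b
lemma2 k' (suc d) 1≤k' (s≤s 1≤d) a b
  with tℕ-endpoints k' 1≤k' d 1≤d (toℕ<n a) (toℕ<n b)
... | i , tℕ-i , tℕ-i+d =
  subst₂ (InBoundary (t k') (suc d)) (toℕ-injective tℕ-i) (toℕ-injective tℕ-i+d) (factorAt-boundary (t k') i d)
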